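{- Let $\nu,j\ge1$ and $m\ge0$. Then $T_\rho(\nu,m,j)\star\rho(\nu,1,m+1)\sim T_\rho(\nu,m,j+1)$, and, if $\nu$ divides $m$, $T_\tau(\nu,m,j)\star\tau(\nu,1,m+1)\sim T_\tau(\nu,m,j+1)$.
   Context: Alphabet $\Sigma=\mathbb{N}$; words are finite sequences over $\Sigma$, $|w|$ is length, $w^R$ the reverse. An equivalence map is a morphism of $\Sigma^*$ induced by a bijection $\Sigma\to\Sigma$; $x\sim y$ means $f(x)=y$ for some equivalence map $f$. A double occurrence word (DOW) is a word in which every symbol occurs zero or exactly two times. A word is in ascending order if it is empty or its first symbol is $1$ and the first occurrence of each symbol is one greater than the largest symbol preceding it. Insertions: for a DOW $w$ in ascending order with largest symbol $M$ ($M=0$ if $w$ is empty), $\nu\ge1$, $u=(M+1)\cdots(M+\nu)$ and $1\le k\le\ell\le|w|+1$, write $w=y_1y_2y_3$ with $|y_1|=k-1$, $|y_1y_2|=\ell-1$; $w\star\rho(\nu,k,\ell)=y_1uy_2uy_3$ and $w\star\tau(\nu,k,\ell)=y_1uy_2u^Ry_3$. For $h,\nu\ge1$ let $x_i=((i-1)\nu+1)\cdots(i\nu)$; $\mathrm{Int}(h,\nu)=x_1\cdots x_hx_1^R\cdots x_h^R$. Tangled cords: for $m\ge0$, $\nu,j\ge1$, let $s_0=12\cdots m12\cdots m$ ($\epsilon$ if $m=0$), $s_j=s_{j-1}\star\rho(\nu,|s_{j-1}|-m+1,|s_{j-1}|+1)$, $T_\rho(\nu,m,j)=s_j$. If $\nu\mid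 m$, let $t_0=\mathrm{Int}(m/\nu,\nu)$ ($\epsilon$ if $m=0$), $t_j=t_{j-1}\star\tau(\nu,|t_{j-1}|-m+1,|t_{j-1}|+1)$, $T_\tau(\nu,m,j)=t_j$. -}

module Defs where

open import Data.Nat using (ℕ; zero; suc; _+_; _*_; _∸_; _⊔_)
open import Data.Nat.Divisibility using (_∣_; quotient)
open import Data.List using (List; []; _∷_; _++_; map; take; drop; length; reverse; upTo; concat; foldr)
open import Data.Product using (∃)
open import Function.Bundles using (_⤖_; Bijection)
open import Relation.Binary.PropositionalEquality using (_≡_)

Word : Set
Word = List ℕ

_∼_ : Word → Word → Set
x ∼ y = ∃ λ (f : ℕ ⤖ ℕ) → map (Bijection.to f) x ≡ y

maxSym : Word → ℕ
maxSym = foldr _⊔_ 0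

block : ℕ → ℕ → Word
block a ν = map (λ i → a + suc i) (upTo ν)

y₁ y₂ y₃ : Word → ℕ → ℕ → Word
y₁ w k ℓ = take (k ∸ 1) w
y₂ w k ℓ = take ((ℓ ∸ 1) ∸ (k ∸ 1)) (drop (k ∸ 1) w)
y₃ w k ℓ = drop (ℓ ∸ 1) w

_⋆ρ[_,_,_] : Word → ℕ → ℕ → ℕ → Word
w ⋆ρ[ ν , k , ℓ ] =
  y₁ w k ℓ ++ block (maxSym w) ν ++ y₂ w k ℓ ++ block (maxSym w) ν ++ y₃ w k ℓ

_⋆τ[_,_,_] : Word → ℕ → ℕ → ℕ → Word
w ⋆τ[ ν , k , ℓ ] =
  y₁ w k ℓ ++ block (maxSym w) ν ++ y₂ w k ℓ ++ reverse (block (maxSym w) ν) ++ y₃ w k ℓ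

xblk : ℕ → ℕ → Word
xblk ν i = block ((i ∸ 1) * ν) ν

Int : ℕ → ℕ → Word
Int h ν = concat (map (λ i → xblk ν (suc i)) (upTo h))
       ++ concat (map (λ i → reverse (xblk ν (suc i))) (upTo h))

s₀ : ℕ → Word
s₀ m = block 0 m ++ block 0 m

Tρ : ℕ → ℕ → ℕ → Word
Tρ ν m zero = s₀ m
Tρ ν m (suc j) = let s = Tρ ν m j in
  s ⋆ρ[ ν , (length s ∸ m) + 1 , length s + 1 ]

Tτ : (ν m : ℕ) → ν ∣ m → ℕ → Word
Tτ ν m d zero = Int (quotient d) ν
Tτ ν m d (suc j) = let t = Tτ ν m d j in
  t ⋆τ[ ν , (length t ∸ m) + 1 , length t + 1 ]

-- Let σ be id (for ρ) or reverse (for τ), and M = jν + m. By induction the j-th cord is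
-- 1⋯m · c₀ ⋯ c_{j-1} · L_j, where c_i = (iν+m+1)⋯(iν+m+ν) · σ((iν+1)⋯(iν+ν)) comes from the
-- i-th insertion at the back, L_{j+1} is L_j shifted up by ν, and M is the largest letter.
-- Inserting u = (M+1)⋯(M+ν) at the front gives u · 1⋯m · σu · c₀ ⋯ c_{j-1} · L_j. The cyclic
-- permutation of {1, …, M+ν} sending u to 1⋯ν and every other letter x to x + ν turns this into
-- 1⋯ν · (ν+1)⋯(ν+m) · σ(1⋯ν) · c₁ ⋯ c_j · L_{j+1} = 1⋯m · c₀ ⋯ c_j · L_{j+1}, the (j+1)-st cord.
-- The only property of the initial tail L₀ (1⋯m for ρ, x₁ᴿ⋯x_hᴿ for τ) that this uses is
-- L₀ · σ((m+1)⋯(m+ν)) = σ(1⋯ν) · (L₀ shifted up by ν).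

module Submission where

open import Defs
open import Data.Nat using (ℕ; zero; suc; _+_; _*_; _∸_; _⊔_; _≤_; _<_; _≤?_; z≤n; s≤s; z<s)
open import Data.Nat.Properties
open import Data.Nat.Divisibility using (_∣_; divides)
open import Data.List using ([]; _∷_; [_]; _++_; map; take; drop; length; reverse; upTo; applyUpTo; concat)
open import Data.List.Properties
  using (map-++; map-∘; map-cong; map-cong-local; map-id; map-upTo; length-++; length-map; length-reverse;
         ++-assoc; ++-identityʳ; concat-++; applyUpTo-∷ʳ; drop-drop; reverse-map)
open import Data.List.Relation.Unary.All as All using (All; []; _∷_)
open import Data.List.Relation.Unary.All.Properties using (++⁺; map⁺; concat⁺; applyUpTo⁺₁)
import Data.List.Relation.Unary.Any.Properties as Any
open import Data.Product using (_×_; _,_)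
open import Function using (id; _∘_)
open import Function.Bundles using (_⤖_; mk↔ₛ′)
open import Function.Properties.Inverse using (↔⇒⤖)
open import Relation.Nullary using (yes; no)
open import Relation.Nullary.Negation using (contradiction)
open import Relation.Binary.PropositionalEquality using (_≡_; refl; sym; trans; cong; cong₂; subst; subst₂; module ≡-Reasoning)
open ≡-Reasoning

block′ : ℕ → ℕ → Word
block′ a zero = []
block′ a (suc n) = suc a ∷ block′ (suc a) n

block≡block′ : ∀ a n → block a n ≡ block′ a n
block≡block′ a n = trans (map-upTo (λ i → a + suc i) n) (applyUpTo≡block′ a n (λ _ → refl))
  where
  applyUpTo≡block′ : ∀ a n {g : ℕ → ℕ} → (∀ i → g i ≡ a + suc i) → applyUpTo g n ≡ block′ a n
  applyUpTo≡block′ a zero g≗ = refl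
  applyUpTo≡block′ a (suc n) g≗ =
    cong₂ _∷_ (trans (g≗ 0) (+-comm a 1))
              (applyUpTo≡block′ (suc a) n (λ i → trans (g≗ (suc i)) (+-suc a (suc i))))

length-block′ : ∀ a n → length (block′ a n) ≡ n
length-block′ a zero = refl
length-block′ a (suc n) = cong suc (length-block′ (suc a) n)

block′-++ : ∀ a n k → block′ a (n + k) ≡ block′ a n ++ block′ (a + n) k
block′-++ a zero k = cong (λ b → block′ b k) (sym (+-identityʳ a))
block′-++ a (suc n) k = cong (suc a ∷_)
  (trans (block′-++ (suc a) n k) (cong (λ b → block′ (suc a) n ++ block′ b k) (sym (+-suc a n))))

block′-swap : ∀ a p q → block′ a p ++ block′ (a + p) q ≡ block′ a q ++ block′ (a + q) p
block′-swap a p q = begin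
  block′ a p ++ block′ (a + p) q ≡⟨ block′-++ a p q ⟨
  block′ a (p + q)               ≡⟨ cong (block′ a) (+-comm p q) ⟩
  block′ a (q + p)               ≡⟨ block′-++ a q p ⟩
  block′ a q ++ block′ (a + q) p ∎

shift : ℕ → Word → Word
shift k = map (k +_)

shift-block′ : ∀ k a n → shift k (block′ a n) ≡ block′ (k + a) n
shift-block′ k a zero = refl
shift-block′ k a (suc n) =
  trans (cong (k + suc a ∷_) (shift-block′ k (suc a) n)) (cong (λ b → b ∷ block′ b n) (+-suc k a))

shift-block′-zero : ∀ k n → shift k (block′ 0 n) ≡ block′ k n
shift-block′-zero k n = trans (shift-block′ k 0 n) (cong (λ b → block′ b n) (+-identityʳ k))

Over : ℕ → Word → Set
Over M = All (λ x → 1 ≤ x × x ≤ M)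

Over-mono : ∀ {M N w} → M ≤ N → Over M w → Over N w
Over-mono M≤N = All.map (λ (1≤x , x≤M) → 1≤x , ≤-trans x≤M M≤N)

Over-block′ : ∀ {M} a n → a + n ≤ M → Over M (block′ a n)
Over-block′ a zero a≤M = []
Over-block′ {M} a (suc n) a+n≤M =
  (s≤s z≤n , ≤-trans (s≤s (m≤m+n a n)) a+n≤M′) ∷ Over-block′ (suc a) n a+n≤M′
  where
  a+n≤M′ : suc a + n ≤ M
  a+n≤M′ = subst (_≤ M) (+-suc a n) a+n≤M

Over-shift : ∀ {M} k {w} → Over M w → Over (k + M) (shift k w)
Over-shift k = map⁺ ∘ All.map (λ {x} (1≤x , x≤M) → ≤-trans 1≤x (m≤n+m x k) , +-monoʳ-≤ k x≤M)

Over-reverse : ∀ {M w} → Over M w → Over M (reverse w)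
Over-reverse ow = All.tabulate (All.lookup ow ∘ Any.reverse⁻)

maxSym-++ : ∀ xs ys → maxSym (xs ++ ys) ≡ maxSym xs ⊔ maxSym ys
maxSym-++ [] ys = refl
maxSym-++ (x ∷ xs) ys = trans (cong (x ⊔_) (maxSym-++ xs ys)) (sym (⊔-assoc x (maxSym xs) (maxSym ys)))

maxSym-≤ : ∀ {M w} → Over M w → maxSym w ≤ M
maxSym-≤ [] = z≤n
maxSym-≤ ((_ , x≤M) ∷ ow) = ⊔-lub x≤M (maxSym-≤ ow)

maxSym-++-Over : ∀ xs {ys} → Over (maxSym xs) ys → maxSym (xs ++ ys) ≡ maxSym xs
maxSym-++-Over xs {ys} oys = trans (maxSym-++ xs ys) (m≥n⇒m⊔n≡m (maxSym-≤ oys))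

⊔-maxSym-block′ : ∀ a n → a ⊔ maxSym (block′ a n) ≡ a + n
⊔-maxSym-block′ a zero = trans (⊔-identityʳ a) (sym (+-identityʳ a))
⊔-maxSym-block′ a (suc n) = begin
  a ⊔ (suc a ⊔ maxSym (block′ (suc a) n)) ≡⟨ ⊔-assoc a (suc a) _ ⟨
  (a ⊔ suc a) ⊔ maxSym (block′ (suc a) n) ≡⟨ cong (_⊔ maxSym (block′ (suc a) n)) (m≤n⇒m⊔n≡n (n≤1+n a)) ⟩
  suc a ⊔ maxSym (block′ (suc a) n)       ≡⟨ ⊔-maxSym-block′ (suc a) n ⟩
  suc a + n                               ≡⟨ +-suc a n ⟨
  a + suc n                               ∎

maxSym-++-block′ : ∀ xs {a} n {ys} → maxSym xs ≡ a → Over (a + n) ys →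
                   maxSym (xs ++ block′ a n ++ ys) ≡ a + n
maxSym-++-block′ xs {a} n {ys} refl oys = begin
  maxSym (xs ++ block′ a n ++ ys)   ≡⟨ cong maxSym (++-assoc xs (block′ a n) ys) ⟨
  maxSym ((xs ++ block′ a n) ++ ys) ≡⟨ maxSym-++-Over (xs ++ block′ a n) (subst (λ M → Over M ys) (sym max≡) oys) ⟩
  maxSym (xs ++ block′ a n)         ≡⟨ max≡ ⟩
  a + n                             ∎
  where
  max≡ : maxSym (xs ++ block′ a n) ≡ a + n
  max≡ = trans (maxSym-++ xs (block′ a n)) (⊔-maxSym-block′ a n)

rotate : ℕ → ℕ → ℕ → ℕ
rotate a b zero = zero
rotate a b (suc x) with suc x ≤? a | suc x ≤? a + b
... | yes _ | _     = b + suc x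
... | no _  | yes _ = suc x ∸ a
... | no _  | no _  = suc x

rotate-low : ∀ {a b y} → 1 ≤ y → y ≤ a → rotate a b y ≡ b + y
rotate-low {a} {b} {suc x} _ x<a with suc x ≤? a
... | yes _ = refl
... | no x≮a = contradiction x<a x≮a

rotate-mid : ∀ {a b y} → a < y → y ≤ a + b → rotate a b y ≡ y ∸ a
rotate-mid {a} {b} {suc x} a<y y≤a+b with suc x ≤? a | suc x ≤? a + b
... | yes y≤a | _     = contradiction y≤a (<⇒≱ a<y)
... | no _    | yes _ = refl
... | no _    | no y≰a+b = contradiction y≤a+b y≰a+b

rotate-high : ∀ {a b y} → a + b < y → rotate a b y ≡ y
rotate-high {a} {b} {suc x} a+b<y with suc x ≤? a | suc x ≤? a + b
... | yes y≤a | _        = contradiction (≤-trans y≤a (m≤m+n a b)) (<⇒≱ a+b<y)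
... | no _    | yes y≤a+b = contradiction y≤a+b (<⇒≱ a+b<y)
... | no _    | no _      = refl

rotate-inverse : ∀ a b y → rotate b a (rotate a b y) ≡ y
rotate-inverse a b zero = refl
rotate-inverse a b (suc x) with suc x ≤? a | suc x ≤? a + b
... | yes y≤a | _ =
  trans (rotate-mid {b} {a} (m<m+n b z<s) (+-monoʳ-≤ b y≤a)) (m+n∸m≡n b (suc x))
... | no y≰a | yes y≤a+b =
  trans (rotate-low {b} {a} (m<n⇒0<n∸m (≰⇒> y≰a)) (m≤n+o⇒m∸n≤o (suc x) a y≤a+b)) (m+[n∸m]≡n (<⇒≤ (≰⇒> y≰a)))
... | no _ | no y≰a+b = rotate-high {b} {a} (subst (_< suc x) (+-comm a b) (≰⇒> y≰a+b))

rotation : ℕ → ℕ → ℕ ⤖ ℕ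
rotation a b = ↔⇒⤖ (mk↔ₛ′ (rotate a b) (rotate b a) (rotate-inverse b a) (rotate-inverse a b))

map-rotate-Over : ∀ {a} b {w} → Over a w → map (rotate a b) w ≡ shift b w
map-rotate-Over b ow = map-cong-local (All.map (λ (1≤x , x≤a) → rotate-low 1≤x x≤a) ow)

map-rotate-block′ : ∀ a b → map (rotate a b) (block′ a b) ≡ block′ 0 b
map-rotate-block′ a b = begin
  map (rotate a b) (block′ a b)                 ≡⟨ cong (map (rotate a b)) (shift-block′-zero a b) ⟨
  map (rotate a b) (shift a (block′ 0 b))       ≡⟨ map-∘ (block′ 0 b) ⟨
  map (rotate a b ∘ (a +_)) (block′ 0 b)        ≡⟨ map-cong-local (All.map rotate-shifted (Over-block′ 0 b ≤-refl)) ⟩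
  map id (block′ 0 b)                           ≡⟨ map-id (block′ 0 b) ⟩
  block′ 0 b                                    ∎
  where
  rotate-shifted : ∀ {x} → 1 ≤ x × x ≤ b → rotate a b (a + x) ≡ x
  rotate-shifted {x} (1≤x , x≤b) = trans (rotate-mid {a} {b} (m<m+n a 1≤x) (+-monoʳ-≤ a x≤b)) (m+n∸m≡n a x)

-- _⋆ρ[_,_,_] and _⋆τ[_,_,_] are definitionally the cases σ = id and σ = reverse.
_⋆⟨_⟩[_,_,_] : Word → (Word → Word) → ℕ → ℕ → ℕ → Word
w ⋆⟨ σ ⟩[ ν , k , ℓ ] = let u = block (maxSym w) ν in y₁ w k ℓ ++ u ++ y₂ w k ℓ ++ σ u ++ y₃ w k ℓ

take-length-++ : ∀ (xs ys : Word) → take (length xs) (xs ++ ys) ≡ xs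
take-length-++ [] ys = refl
take-length-++ (x ∷ xs) ys = cong (x ∷_) (take-length-++ xs ys)

drop-length-++ : ∀ (xs ys : Word) → drop (length xs) (xs ++ ys) ≡ ys
drop-length-++ [] ys = refl
drop-length-++ (x ∷ xs) ys = drop-length-++ xs ys

⋆-segments : ∀ {w} A B C σ ν {k ℓ} → w ≡ A ++ B ++ C → k ≡ suc (length A) → ℓ ≡ suc (length A + length B) →
             let u = block (maxSym w) ν in w ⋆⟨ σ ⟩[ ν , k , ℓ ] ≡ A ++ u ++ B ++ σ u ++ C
⋆-segments {w} A B C σ ν refl refl refl =
  cong₂ (λ p q → p ++ block (maxSym w) ν ++ q) (take-length-++ A (B ++ C))
        (cong₂ (λ q r → q ++ σ (block (maxSym w) ν) ++ r) y₂≡B y₃≡C)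
  where
  y₂≡B : take (length A + length B ∸ length A) (drop (length A) w) ≡ B
  y₂≡B rewrite m+n∸m≡n (length A) (length B) | drop-length-++ A (B ++ C) = take-length-++ B C
  y₃≡C : drop (length A + length B) w ≡ C
  y₃≡C = begin
    drop (length A + length B) w          ≡⟨ drop-drop (length A) (length B) w ⟨
    drop (length B) (drop (length A) w)   ≡⟨ cong (drop (length B)) (drop-length-++ A (B ++ C)) ⟩
    drop (length B) (B ++ C)              ≡⟨ drop-length-++ B C ⟩
    C                                     ∎

⋆-front : ∀ A B σ ν → let u = block (maxSym (A ++ B)) ν in
          (A ++ B) ⋆⟨ σ ⟩[ ν , 1 , length A + 1 ] ≡ u ++ A ++ σ u ++ B
⋆-front A B σ ν = ⋆-segments [] A B σ ν refl refl (+-comm (length A) 1)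

⋆-back : ∀ A B σ ν {m} → length B ≡ m → let u = block (maxSym (A ++ B)) ν in
         (A ++ B) ⋆⟨ σ ⟩[ ν , length (A ++ B) ∸ m + 1 , length (A ++ B) + 1 ] ≡ A ++ u ++ B ++ σ u
⋆-back A B σ ν refl =
  trans (⋆-segments A B [] σ ν (cong (A ++_) (sym (++-identityʳ B))) k≡ ℓ≡)
        (cong (λ v → A ++ u ++ B ++ v) (++-identityʳ (σ u)))
  where
  u = block (maxSym (A ++ B)) ν
  k≡ : length (A ++ B) ∸ length B + 1 ≡ suc (length A)
  k≡ = trans (+-comm _ 1) (cong suc (trans (cong (_∸ length B) (length-++ A)) (m+n∸n≡m (length A) (length B))))
  ℓ≡ : length (A ++ B) + 1 ≡ suc (length A + length B)
  ℓ≡ = trans (+-comm _ 1) (cong suc (length-++ A))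

cord : (Word → Word) → ℕ → ℕ → Word → ℕ → Word
cord σ ν m t₀ zero = t₀
cord σ ν m t₀ (suc j) = let t = cord σ ν m t₀ j in t ⋆⟨ σ ⟩[ ν , length t ∸ m + 1 , length t + 1 ]

concat-applyUpTo-∷ʳ : ∀ (g : ℕ → Word) h → concat (applyUpTo g (suc h)) ≡ concat (applyUpTo g h) ++ g h
concat-applyUpTo-∷ʳ g h = begin
  concat (applyUpTo g (suc h))            ≡⟨ cong concat (applyUpTo-∷ʳ g h) ⟨
  concat (applyUpTo g h ++ [ g h ])       ≡⟨ concat-++ (applyUpTo g h) [ g h ] ⟨
  concat (applyUpTo g h) ++ g h ++ []     ≡⟨ cong (concat (applyUpTo g h) ++_) (++-identityʳ (g h)) ⟩
  concat (applyUpTo g h) ++ g h           ∎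

concat-applyUpTo-shift : ∀ k (g : ℕ → Word) → (∀ i → g (suc i) ≡ shift k (g i)) →
                         ∀ h → concat (applyUpTo (g ∘ suc) h) ≡ shift k (concat (applyUpTo g h))
concat-applyUpTo-shift k g g-suc zero = refl
concat-applyUpTo-shift k g g-suc (suc h) =
  trans (cong₂ _++_ (g-suc 0) (concat-applyUpTo-shift k (g ∘ suc) (g-suc ∘ suc) h))
        (sym (map-++ (k +_) (g 0) _))

length-concat-applyUpTo : ∀ {n} (g : ℕ → Word) → (∀ i → length (g i) ≡ n) →
                          ∀ h → length (concat (applyUpTo g h)) ≡ h * n
length-concat-applyUpTo g len zero = refl
length-concat-applyUpTo g len (suc h) =
  trans (length-++ (g 0)) (cong₂ _+_ (len 0) (length-concat-applyUpTo (g ∘ suc) (len ∘ suc) h))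

module FrontInsertion
  (σ : Word → Word) (σ-map : ∀ f xs → map f (σ xs) ≡ σ (map f xs)) (σ-Over : ∀ {M xs} → Over M xs → Over M (σ xs))
  (ν m : ℕ) (L₀ : Word) (length-L₀ : length L₀ ≡ m) (Over-L₀ : Over m L₀)
  (L₀-σ : L₀ ++ σ (block′ m ν) ≡ σ (block′ 0 ν) ++ shift ν L₀)
  where

  t : ℕ → Word
  t = cord σ ν m (block′ 0 m ++ L₀)

  top : ℕ → ℕ
  top j = j * ν + m

  top-suc : ∀ j → top (suc j) ≡ ν + top j
  top-suc j = +-assoc ν (j * ν) m

  top-+ν : ∀ j → top j + ν ≡ top (suc j)
  top-+ν j = trans (+-comm (top j) ν) (sym (top-suc j))

  shift-σ-block′ : ∀ k a n → shift k (σ (block′ a n)) ≡ σ (block′ (k + a) n)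
  shift-σ-block′ k a n = trans (σ-map (k +_) (block′ a n)) (cong σ (shift-block′ k a n))

  car : ℕ → Word
  car j = block′ (top j) ν ++ σ (block′ (j * ν) ν)

  train : ℕ → Word
  train j = concat (applyUpTo car j)

  tail : ℕ → Word
  tail zero = L₀
  tail (suc j) = shift ν (tail j)

  car-suc : ∀ j → car (suc j) ≡ shift ν (car j)
  car-suc j = begin
    block′ (top (suc j)) ν ++ σ (block′ (suc j * ν) ν)
      ≡⟨ cong (λ a → block′ a ν ++ σ (block′ (suc j * ν) ν)) (top-suc j) ⟩
    block′ (ν + top j) ν ++ σ (block′ (ν + j * ν) ν)
      ≡⟨ cong₂ _++_ (shift-block′ ν (top j) ν) (shift-σ-block′ ν (j * ν) ν) ⟨
    shift ν (block′ (top j) ν) ++ shift ν (σ (block′ (j * ν) ν))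
      ≡⟨ map-++ (ν +_) (block′ (top j) ν) _ ⟨
    shift ν (car j) ∎

  train-suc : ∀ j → train (suc j) ≡ car 0 ++ shift ν (train j)
  train-suc j = cong (car 0 ++_) (concat-applyUpTo-shift ν car car-suc j)

  length-tail : ∀ j → length (tail j) ≡ m
  length-tail zero = length-L₀
  length-tail (suc j) = trans (length-map (ν +_) (tail j)) (length-tail j)

  Over-tail : ∀ j → Over (top j) (tail j)
  Over-tail zero = Over-L₀
  Over-tail (suc j) = subst (λ M → Over M (tail (suc j))) (sym (top-suc j)) (Over-shift ν (Over-tail j))

  tail-σ : ∀ j → tail j ++ σ (block′ (top j) ν) ≡ σ (block′ (j * ν) ν) ++ tail (suc j)
  tail-σ zero = L₀-σ
  tail-σ (suc j) = begin
    tail (suc j) ++ σ (block′ (top (suc j)) ν)           ≡⟨ cong (λ a → tail (suc j) ++ σ (block′ a ν)) (top-suc j) ⟩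
    tail (suc j) ++ σ (block′ (ν + top j) ν)             ≡⟨ cong (tail (suc j) ++_) (shift-σ-block′ ν (top j) ν) ⟨
    tail (suc j) ++ shift ν (σ (block′ (top j) ν))       ≡⟨ map-++ (ν +_) (tail j) _ ⟨
    shift ν (tail j ++ σ (block′ (top j) ν))             ≡⟨ cong (shift ν) (tail-σ j) ⟩
    shift ν (σ (block′ (j * ν) ν) ++ tail (suc j))       ≡⟨ map-++ (ν +_) (σ (block′ (j * ν) ν)) _ ⟩
    shift ν (σ (block′ (j * ν) ν)) ++ tail (suc (suc j)) ≡⟨ cong (_++ tail (suc (suc j))) (shift-σ-block′ ν (j * ν) ν) ⟩
    σ (block′ (suc j * ν) ν) ++ tail (suc (suc j))       ∎

  Over-σ-block′ : ∀ j → Over (top j + ν) (σ (block′ (j * ν) ν))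
  Over-σ-block′ j = σ-Over (Over-block′ (j * ν) ν (+-monoˡ-≤ ν (m≤m+n (j * ν) m)))

  Over-train : ∀ j → Over (top j) (train j)
  Over-train j = concat⁺ (applyUpTo⁺₁ car j Over-car)
    where
    Over-car : ∀ {i} → i < j → Over (top j) (car i)
    Over-car {i} i<j = ++⁺ (Over-block′ (top i) ν top-i+ν≤) (Over-mono top-i+ν≤ (Over-σ-block′ i))
      where
      top-i+ν≤ : top i + ν ≤ top j
      top-i+ν≤ = subst (_≤ top j) (sym (top-+ν i)) (+-monoˡ-≤ m (*-monoˡ-≤ ν i<j))

  maxSym-prefix : ∀ j → maxSym (block′ 0 m ++ train j) ≡ top j
  maxSym-prefix zero = maxSym-++-block′ [] m refl []
  maxSym-prefix (suc j) = begin
    maxSym (block′ 0 m ++ train (suc j))   ≡⟨ cong (λ c → maxSym (block′ 0 m ++ c)) (concat-applyUpTo-∷ʳ car j) ⟩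
    maxSym (block′ 0 m ++ train j ++ car j) ≡⟨ cong maxSym (++-assoc (block′ 0 m) (train j) (car j)) ⟨
    maxSym ((block′ 0 m ++ train j) ++ car j)
      ≡⟨ maxSym-++-block′ (block′ 0 m ++ train j) ν (maxSym-prefix j) (Over-σ-block′ j) ⟩
    top j + ν                              ≡⟨ top-+ν j ⟩
    top (suc j)                            ∎

  maxSym-t : ∀ j → maxSym ((block′ 0 m ++ train j) ++ tail j) ≡ top j
  maxSym-t j = trans (maxSym-++-Over (block′ 0 m ++ train j) Over-tail′) (maxSym-prefix j)
    where
    Over-tail′ : Over (maxSym (block′ 0 m ++ train j)) (tail j)
    Over-tail′ = subst (λ M → Over M (tail j)) (sym (maxSym-prefix j)) (Over-tail j)

  t-form : ∀ j → t j ≡ block′ 0 m ++ train j ++ tail j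
  t-form zero = refl
  t-form (suc j) = begin
    t (suc j)
      ≡⟨ cong (λ w → w ⋆⟨ σ ⟩[ ν , length w ∸ m + 1 , length w + 1 ])
              (trans (t-form j) (sym (++-assoc (block′ 0 m) (train j) (tail j)))) ⟩
    (P ++ tail j) ⋆⟨ σ ⟩[ ν , length (P ++ tail j) ∸ m + 1 , length (P ++ tail j) + 1 ]
      ≡⟨ ⋆-back P (tail j) σ ν (length-tail j) ⟩
    P ++ u ++ tail j ++ σ u                                  ≡⟨ cong (λ v → P ++ v ++ tail j ++ σ v) u≡ ⟩
    P ++ block′ (top j) ν ++ tail j ++ σ (block′ (top j) ν) ≡⟨ cong (λ r → P ++ block′ (top j) ν ++ r) (tail-σ j) ⟩
    P ++ block′ (top j) ν ++ σ (block′ (j * ν) ν) ++ tail (suc j)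
      ≡⟨ cong (P ++_) (++-assoc (block′ (top j) ν) (σ (block′ (j * ν) ν)) (tail (suc j))) ⟨
    P ++ car j ++ tail (suc j)                               ≡⟨ ++-assoc P (car j) (tail (suc j)) ⟨
    (P ++ car j) ++ tail (suc j)                             ≡⟨ cong (_++ tail (suc j)) (++-assoc (block′ 0 m) (train j) (car j)) ⟩
    (block′ 0 m ++ train j ++ car j) ++ tail (suc j)
      ≡⟨ cong (λ c → (block′ 0 m ++ c) ++ tail (suc j)) (concat-applyUpTo-∷ʳ car j) ⟨
    (block′ 0 m ++ train (suc j)) ++ tail (suc j)            ≡⟨ ++-assoc (block′ 0 m) (train (suc j)) (tail (suc j)) ⟩
    block′ 0 m ++ train (suc j) ++ tail (suc j)              ∎
    where
    P = block′ 0 m ++ train j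
    u = block (maxSym (P ++ tail j)) ν
    u≡ : u ≡ block′ (top j) ν
    u≡ = trans (cong (λ a → block a ν) (maxSym-t j)) (block≡block′ (top j) ν)

  t-front : ∀ j → let M = top j ; R = train j ++ tail j in
            t j ⋆⟨ σ ⟩[ ν , 1 , m + 1 ] ≡ block′ M ν ++ block′ 0 m ++ σ (block′ M ν) ++ R
  t-front j = begin
    t j ⋆⟨ σ ⟩[ ν , 1 , m + 1 ]                 ≡⟨ cong (_⋆⟨ σ ⟩[ ν , 1 , m + 1 ]) (t-form j) ⟩
    (block′ 0 m ++ R) ⋆⟨ σ ⟩[ ν , 1 , m + 1 ]
      ≡⟨ cong (λ n → (block′ 0 m ++ R) ⋆⟨ σ ⟩[ ν , 1 , n + 1 ]) (length-block′ 0 m) ⟨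
    (block′ 0 m ++ R) ⋆⟨ σ ⟩[ ν , 1 , length (block′ 0 m) + 1 ] ≡⟨ ⋆-front (block′ 0 m) R σ ν ⟩
    u ++ block′ 0 m ++ σ u ++ R                 ≡⟨ cong (λ v → v ++ block′ 0 m ++ σ v ++ R) u≡ ⟩
    block′ (top j) ν ++ block′ 0 m ++ σ (block′ (top j) ν) ++ R ∎
    where
    R = train j ++ tail j
    u = block (maxSym (block′ 0 m ++ R)) ν
    u≡ : u ≡ block′ (top j) ν
    u≡ = trans (cong (λ a → block a ν)
                 (trans (cong maxSym (sym (++-assoc (block′ 0 m) (train j) (tail j)))) (maxSym-t j)))
               (block≡block′ (top j) ν)

  rotate-t-front : ∀ j → let M = top j ; R = train j ++ tail j in
                   map (rotate M ν) (block′ M ν ++ block′ 0 m ++ σ (block′ M ν) ++ R) ≡ t (suc j)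
  rotate-t-front j = begin
    map f (block′ M ν ++ block′ 0 m ++ σ (block′ M ν) ++ R)
      ≡⟨ trans (map-++ f (block′ M ν) _) (cong (map f (block′ M ν) ++_)
           (trans (map-++ f (block′ 0 m) _) (cong (map f (block′ 0 m) ++_) (map-++ f (σ (block′ M ν)) R)))) ⟩
    map f (block′ M ν) ++ map f (block′ 0 m) ++ map f (σ (block′ M ν)) ++ map f R
      ≡⟨ cong₂ _++_ (map-rotate-block′ M ν) (cong₂ _++_ rotate-prefix (cong₂ _++_ rotate-σ rotate-R)) ⟩
    block′ 0 ν ++ block′ ν m ++ σ (block′ 0 ν) ++ shift ν (train j) ++ tail (suc j)
      ≡⟨ ++-assoc (block′ 0 ν) (block′ ν m) _ ⟨
    (block′ 0 ν ++ block′ ν m) ++ σ (block′ 0 ν) ++ shift ν (train j) ++ tail (suc j)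
      ≡⟨ cong (_++ (σ (block′ 0 ν) ++ shift ν (train j) ++ tail (suc j))) (block′-swap 0 ν m) ⟩
    (block′ 0 m ++ block′ m ν) ++ σ (block′ 0 ν) ++ shift ν (train j) ++ tail (suc j)
      ≡⟨ ++-assoc (block′ 0 m) (block′ m ν) _ ⟩
    block′ 0 m ++ block′ m ν ++ σ (block′ 0 ν) ++ shift ν (train j) ++ tail (suc j)
      ≡⟨ cong (block′ 0 m ++_) (trans (sym (++-assoc (block′ m ν) _ _)) (sym (++-assoc (car 0) _ _))) ⟩
    block′ 0 m ++ (car 0 ++ shift ν (train j)) ++ tail (suc j)
      ≡⟨ cong (λ c → block′ 0 m ++ c ++ tail (suc j)) (train-suc j) ⟨
    block′ 0 m ++ train (suc j) ++ tail (suc j) ≡⟨ t-form (suc j) ⟨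
    t (suc j) ∎
    where
    M = top j
    R = train j ++ tail j
    f = rotate M ν
    rotate-prefix : map f (block′ 0 m) ≡ block′ ν m
    rotate-prefix = trans (map-rotate-Over ν (Over-block′ 0 m (m≤n+m m (j * ν)))) (shift-block′-zero ν m)
    rotate-σ : map f (σ (block′ M ν)) ≡ σ (block′ 0 ν)
    rotate-σ = trans (σ-map f (block′ M ν)) (cong σ (map-rotate-block′ M ν))
    rotate-R : map f R ≡ shift ν (train j) ++ tail (suc j)
    rotate-R = trans (map-rotate-Over ν (++⁺ (Over-train j) (Over-tail j))) (map-++ (ν +_) (train j) (tail j))

  front-step : ∀ j → (t j ⋆⟨ σ ⟩[ ν , 1 , m + 1 ]) ∼ t (suc j)
  front-step j = rotation (top j) ν , trans (cong (map (rotate (top j) ν)) (t-front j)) (rotate-t-front j)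

Tρ≡cord : ∀ ν m j → Tρ ν m j ≡ cord id ν m (block′ 0 m ++ block′ 0 m) j
Tρ≡cord ν m zero = cong₂ _++_ (block≡block′ 0 m) (block≡block′ 0 m)
Tρ≡cord ν m (suc j) = cong (λ s → s ⋆⟨ id ⟩[ ν , length s ∸ m + 1 , length s + 1 ]) (Tρ≡cord ν m j)

module Repeat (ν m : ℕ) = FrontInsertion id (λ _ _ → refl) id ν m (block′ 0 m) (length-block′ 0 m)
  (Over-block′ 0 m ≤-refl) (trans (block′-swap 0 m ν) (cong (block′ 0 ν ++_) (sym (shift-block′-zero ν m))))

ρ-front-insertion : ∀ ν m j → (Tρ ν m j ⋆ρ[ ν , 1 , m + 1 ]) ∼ Tρ ν m (j + 1)
ρ-front-insertion ν m j =
  subst₂ _∼_ (cong (_⋆ρ[ ν , 1 , m + 1 ]) (sym (Tρ≡cord ν m j)))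
             (sym (trans (cong (Tρ ν m) (+-comm j 1)) (Tρ≡cord ν m (suc j))))
             (Repeat.front-step ν m j)

concat-blocks : ∀ ν h → concat (applyUpTo (λ i → block′ (i * ν) ν) h) ≡ block′ 0 (h * ν)
concat-blocks ν zero = refl
concat-blocks ν (suc h) = begin
  block′ 0 ν ++ concat (applyUpTo (λ i → block′ (suc i * ν) ν) h)
    ≡⟨ cong (block′ 0 ν ++_) (concat-applyUpTo-shift ν _ (λ i → sym (shift-block′ ν (i * ν) ν)) h) ⟩
  block′ 0 ν ++ shift ν (concat (applyUpTo (λ i → block′ (i * ν) ν) h))
    ≡⟨ cong (λ c → block′ 0 ν ++ shift ν c) (concat-blocks ν h) ⟩
  block′ 0 ν ++ shift ν (block′ 0 (h * ν)) ≡⟨ cong (block′ 0 ν ++_) (shift-block′-zero ν (h * ν)) ⟩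
  block′ 0 ν ++ block′ ν (h * ν)           ≡⟨ block′-++ 0 ν (h * ν) ⟨
  block′ 0 (suc h * ν)                     ∎

reversedBlocks : ℕ → ℕ → Word
reversedBlocks ν h = concat (applyUpTo (λ i → reverse (block′ (i * ν) ν)) h)

Int-split : ∀ h ν → Int h ν ≡ block′ 0 (h * ν) ++ reversedBlocks ν h
Int-split h ν = cong₂ _++_
  (trans (cong concat (trans (map-cong (λ i → block≡block′ (i * ν) ν) (upTo h)) (map-upTo _ h))) (concat-blocks ν h))
  (cong concat (trans (map-cong (λ i → cong reverse (block≡block′ (i * ν) ν)) (upTo h)) (map-upTo _ h)))

Tτ≡cord : ∀ ν h j → Tτ ν (h * ν) (divides h refl) j ≡ cord reverse ν (h * ν) (block′ 0 (h * ν) ++ reversedBlocks ν h) j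
Tτ≡cord ν h zero = Int-split h ν
Tτ≡cord ν h (suc j) = cong (λ s → s ⋆⟨ reverse ⟩[ ν , length s ∸ h * ν + 1 , length s + 1 ]) (Tτ≡cord ν h j)

module Return (ν h : ℕ) where
  g : ℕ → Word
  g i = reverse (block′ (i * ν) ν)

  g-suc : ∀ i → g (suc i) ≡ shift ν (g i)
  g-suc i = sym (trans (reverse-map (ν +_) (block′ (i * ν) ν)) (cong reverse (shift-block′ ν (i * ν) ν)))

  length-reversedBlocks : length (reversedBlocks ν h) ≡ h * ν
  length-reversedBlocks = length-concat-applyUpTo g (λ i → trans (length-reverse (block′ (i * ν) ν)) (length-block′ (i * ν) ν)) h

  Over-reversedBlocks : Over (h * ν) (reversedBlocks ν h)
  Over-reversedBlocks = concat⁺ (applyUpTo⁺₁ g h (λ {i} i<h →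
    Over-reverse (Over-block′ (i * ν) ν (subst (_≤ h * ν) (+-comm ν (i * ν)) (*-monoˡ-≤ ν i<h)))))

  reversedBlocks-σ : reversedBlocks ν h ++ g h ≡ g 0 ++ shift ν (reversedBlocks ν h)
  reversedBlocks-σ = trans (sym (concat-applyUpTo-∷ʳ g h)) (cong (g 0 ++_) (concat-applyUpTo-shift ν g g-suc h))

  open FrontInsertion reverse reverse-map Over-reverse ν (h * ν) (reversedBlocks ν h)
    length-reversedBlocks Over-reversedBlocks reversedBlocks-σ public

τ-front-insertion : ∀ ν m j (d : ν ∣ m) → (Tτ ν m d j ⋆τ[ ν , 1 , m + 1 ]) ∼ Tτ ν m d (j + 1)
τ-front-insertion ν .(h * ν) j (divides h refl) =
  subst₂ _∼_ (cong (_⋆τ[ ν , 1 , h * ν + 1 ]) (sym (Tτ≡cord ν h j)))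
             (sym (trans (cong (Tτ ν (h * ν) (divides h refl)) (+-comm j 1)) (Tτ≡cord ν h (suc j))))
             (Return.front-step ν h j)

corollary3p12 : (ν m j : ℕ) → 1 ≤ ν → 1 ≤ j →
    ((Tρ ν m j ⋆ρ[ ν , 1 , m + 1 ]) ∼ Tρ ν m (j + 1))
    × ((d : ν ∣ m) → (Tτ ν m d j ⋆τ[ ν , 1 , m + 1 ]) ∼ Tτ ν m d (j + 1))
corollary3p12 ν m j _ _ = ρ-front-insertion ν m j , τ-front-insertion ν m j
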